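{- Let $a_1/q_1<a_2/q_2$ with integers $0<a_i<q_i$ and $a_2q_1-a_1q_2=1$. Let $\bar n$ denote the multiplicative inverse of $n$ modulo $q_1$ in $[1,q_1)$ and $\bar{\bar n}$ the multiplicative inverse of $n$ modulo $q_2$ in $[1,q_2)$. Let $a_*/q_*:=(a_1+a_2)/(q_1+q_2)$. Then (i) $h(a_1/q_1)=(3+\lfloor q_2/q_1\rfloor)q_1-q_2-\bar q_2=(2+\lfloor q_2/q_1\rfloor)q_1-q_2+\dfrac{q_1\bar{\bar q}_1-1}{q_2}$; (ii) $h(a_2/q_2)=(1-\lfloor q_1/q_2\rfloor)q_2+q_1+\bar{\bar q}_1=q_1+(2-\lfloor q_1/q_2\rfloor)q_2-\dfrac{q_2\bar q_2-1}{q_1}$; (iii) $h(a_*/q_*)=3q_1+q_2+\bar{\bar q}_1-\bar q_2$.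
   Context: For a reduced fraction $a/q$ with $1\le a<q$, $h(a/q):=q+a+a'$ where $a'$ is the multiplicative inverse of $a$ modulo $q$ in $[1,q)$. -}

module Defs where

open import Data.Nat using (ℕ; zero; suc; _+_; _*_; _%_; _≡ᵇ_)
open import Data.Bool using (if_then_else_)

-- invmod q n : the multiplicative inverse of n modulo q, taken in [1, q).
-- Implemented by searching m = q-1, q-2, ..., 1 for the (unique, when
-- gcd(n,q) = 1 and q ≥ 2) m with n * m ≡ 1 (mod q); returns 0 if none exists
-- (this default is never used under the hypotheses of the lemma).
invmod : ℕ → ℕ → ℕ
invmod zero    n = 0
invmod (suc k) n = go k
  where
  go : ℕ → ℕ
  go zero    = 0
  go (suc m) = if ((n * suc m) % suc k) ≡ᵇ 1 then suc m else go m

h : ℕ → ℕ → ℕ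
h a q = q + a + invmod q a

{-# OPTIONS --safe #-}
-- Everything follows from a₂q₁ − a₁q₂ = 1. Modulo q₁ it says a₁q₂ ≡ −1, so the inverse
-- of a₁ is −q₂ ≡ q₁ − (q₂ mod q₁) and that of q₂ is q₁ − a₁; modulo q₂ it says a₂q₁ ≡ 1, so
-- the inverse of a₂ is q₁ mod q₂ and that of q₁ is a₂; and (a₁+a₂)q₁ = 1 + a₁(q₁+q₂) makes
-- q₁ the inverse of a₁+a₂ modulo q₁+q₂. The two quotients are exact: q₁a₂ − 1 = a₁q₂, and
-- q₂(q₁−a₁) − 1 = (q₂−a₂)q₁ because reflecting the pair in 1/2 keeps it adjacent.
-- Substituting these values and the two Euclidean divisions of q₁, q₂ by each other turns
-- every claimed formula into a polynomial identity.
module Submission where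

open import Defs
open import Data.Nat using (ℕ; zero; suc; _≤_; _<_; z≤n; _∸_; _%_; _/_; _≡ᵇ_; NonZero; >-nonZero)
open import Data.Nat.Properties
  using (≡ᵇ⇒≡; ≡⇒≡ᵇ; ≤-refl; ≤-pred; ≤-<-trans; <-≤-trans; <-trans; <⇒≤; n<1+n; m≤n⇒m<n∨m≡n
        ; 0≢1+n; m≤m+n; m<m+n; m∸n≤m; m∸n+n≡m; +-∸-assoc; +-assoc; +-comm; *-comm
        ; *-zeroʳ; *-identityʳ; *-distribʳ-+; *-distribʳ-∸; *-monoˡ-≤)
open import Data.Nat.DivMod
  using (m≡m%n+[m/n]*n; m<n⇒m%n≡m; m*n%n≡0; m%n≤n; m%n%n≡m%n; [m+kn]%n≡m%n
        ; %-distribˡ-*; %-remove-+ʳ; m*n/n≡m)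
open import Data.Nat.Divisibility using (_∣_; divides; ∣n⇒∣m*n)
open import Data.Bool using (true; false; if_then_else_)
open import Data.Unit using (tt)
open import Data.Sum using (inj₁; inj₂)
open import Data.Product using (_×_; _,_)
open import Data.List using (_∷_; [])
open import Relation.Nullary using (contradiction)
open import Relation.Binary.PropositionalEquality
  using (_≡_; refl; sym; trans; cong; cong₂; subst; module ≡-Reasoning)
import Data.Nat as N

open ≡-Reasoning

-- Natural-number arithmetic is opened only in this block: the integer operators
-- opened after it must be unqualified in the statement of lemma12.
module _ where
  open N using (_+_; _*_)
  open import Data.Nat.Tactic.RingSolver using (solve; solve-∀)

  -- invmod's search loop is local to a where block. Declared as a metavariable it is
  -- solved by unifying with one unfolding of invmod, in which abstracting suc k
  -- makes the unification problem a pattern.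
  mutual
    invmod-loop : ℕ → ℕ → ℕ → ℕ
    invmod-loop k n j = _

    invmod-unfold : ∀ k n → invmod (suc (suc k)) n
                          ≡ (if (n * suc k) % suc (suc k) ≡ᵇ 1 then suc k else invmod-loop (suc k) n k)
    invmod-unfold k n with suc k
    ... | _ = refl

  invmod≡invmod-loop : ∀ k n → invmod (suc k) n ≡ invmod-loop k n k
  invmod≡invmod-loop zero    n = refl
  invmod≡invmod-loop (suc k) n = invmod-unfold k n

  n%d≡1⇒[m*n]%d≡m%d : ∀ m {n d} .{{_ : NonZero d}} → n % d ≡ 1 → (m * n) % d ≡ m % d
  n%d≡1⇒[m*n]%d≡m%d m {n} {d} n%d≡1 = begin
    (m * n) % d              ≡⟨ %-distribˡ-* m n d ⟩
    ((m % d) * (n % d)) % d  ≡⟨ cong (λ t → ((m % d) * t) % d) n%d≡1 ⟩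
    ((m % d) * 1) % d        ≡⟨ cong (_% d) (*-identityʳ (m % d)) ⟩
    m % d % d                ≡⟨ m%n%n≡m%n m d ⟩
    m % d                    ∎

  inverse-unique : ∀ {q n i m} .{{_ : NonZero q}} → i < q → m < q →
                   (n * i) % q ≡ 1 → (n * m) % q ≡ 1 → i ≡ m
  inverse-unique {q} {n} {i} {m} i<q m<q ni≡1 nm≡1 = begin
    i                  ≡⟨ m<n⇒m%n≡m i<q ⟨
    i % q              ≡⟨ n%d≡1⇒[m*n]%d≡m%d i nm≡1 ⟨
    (i * (n * m)) % q  ≡⟨ cong (_% q) (solve (i ∷ n ∷ m ∷ [])) ⟩
    (m * (n * i)) % q  ≡⟨ n%d≡1⇒[m*n]%d≡m%d m ni≡1 ⟩
    m % q              ≡⟨ m<n⇒m%n≡m m<q ⟩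
    m                  ∎

  invmod-loop-finds : ∀ {k n m} j → j < suc k → m ≤ j → (n * m) % suc k ≡ 1 → invmod-loop k n j ≡ m
  invmod-loop-finds {k} {n} zero _ z≤n n0≡1 =
    contradiction (trans (cong (_% suc k) (sym (*-zeroʳ n))) n0≡1) 0≢1+n
  invmod-loop-finds {k} {n} {m} (suc j) j<q m≤j nm≡1
    with (n * suc j) % suc k ≡ᵇ 1 | ≡ᵇ⇒≡ ((n * suc j) % suc k) 1 | ≡⇒≡ᵇ ((n * suc j) % suc k) 1
  ... | true  | found | _ = inverse-unique {n = n} j<q (≤-<-trans m≤j j<q) (found tt) nm≡1
  ... | false | _ | not-found with m≤n⇒m<n∨m≡n m≤j
  ...   | inj₁ m<1+j = invmod-loop-finds j (<-trans (n<1+n j) j<q) (≤-pred m<1+j) nm≡1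
  ...   | inj₂ refl  = contradiction nm≡1 not-found

  inverse⇒invmod≡ : ∀ {q n m} .{{_ : NonZero q}} → m ≤ q → (n * m) % q ≡ 1 → invmod q n ≡ m
  inverse⇒invmod≡ {suc k} {n} {m} m≤q nm≡1 =
    trans (invmod≡invmod-loop k n) (invmod-loop-finds k ≤-refl m≤k nm≡1)
    where
    m≤k : m ≤ k
    m≤k with m≤n⇒m<n∨m≡n m≤q
    ... | inj₁ m<q = ≤-pred m<q
    ... | inj₂ refl = contradiction (trans (sym (m*n%n≡0 n (suc k))) nm≡1) 0≢1+n

  n*m≡1+c*q⇒invmod≡m%q : ∀ {q n m} c .{{_ : NonZero q}} → 1 < q → n * m ≡ 1 + c * q → invmod q n ≡ m % q
  n*m≡1+c*q⇒invmod≡m%q {q} {n} {m} c 1<q nm≡1+cq = inverse⇒invmod≡ (m%n≤n m q) (begin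
    (n * (m % q)) % q            ≡⟨ %-distribˡ-* n (m % q) q ⟩
    ((n % q) * (m % q % q)) % q  ≡⟨ cong (λ t → ((n % q) * t) % q) (m%n%n≡m%n m q) ⟩
    ((n % q) * (m % q)) % q      ≡⟨ %-distribˡ-* n m q ⟨
    (n * m) % q                  ≡⟨ cong (_% q) nm≡1+cq ⟩
    (1 + c * q) % q              ≡⟨ [m+kn]%n≡m%n 1 c q ⟩
    1 % q                        ≡⟨ m<n⇒m%n≡m 1<q ⟩
    1                            ∎)

  n∣[n∸m%n]+m : ∀ m n .{{_ : NonZero n}} → n ∣ (n ∸ m % n) + m
  n∣[n∸m%n]+m m n = divides (1 + m / n) (begin
    n ∸ m % n + m                    ≡⟨ cong (n ∸ m % n +_) (m≡m%n+[m/n]*n m n) ⟩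
    n ∸ m % n + (m % n + m / n * n)  ≡⟨ +-assoc (n ∸ m % n) (m % n) (m / n * n) ⟨
    n ∸ m % n + m % n + m / n * n    ≡⟨ cong (_+ m / n * n) (m∸n+n≡m (m%n≤n m n)) ⟩
    n + m / n * n                    ∎)

  n*m+1≡c*q⇒invmod≡q∸m%q : ∀ {q n m} c .{{_ : NonZero q}} → 1 < q → n * m + 1 ≡ c * q →
                           invmod q n ≡ q ∸ m % q
  n*m+1≡c*q⇒invmod≡q∸m%q {q} {n} {m} c 1<q nm+1≡cq = inverse⇒invmod≡ (m∸n≤m q (m % q)) (begin
    (n * (q ∸ m % q)) % q                  ≡⟨ %-remove-+ʳ (n * (q ∸ m % q)) (divides c nm+1≡cq) ⟨
    (n * (q ∸ m % q) + (n * m + 1)) % q    ≡⟨ cong (_% q) (regroup n (q ∸ m % q) m) ⟩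
    (1 + n * (q ∸ m % q + m)) % q          ≡⟨ %-remove-+ʳ 1 (∣n⇒∣m*n n (n∣[n∸m%n]+m m q)) ⟩
    1 % q                                  ≡⟨ m<n⇒m%n≡m 1<q ⟩
    1                                      ∎)
    where
    regroup : ∀ a x y → a * x + (a * y + 1) ≡ 1 + a * (x + y)
    regroup = solve-∀

  m≡1+n*o⇒[m∸1]/o≡n : ∀ {m n o} .{{_ : NonZero o}} → m ≡ 1 + n * o → (m ∸ 1) / o ≡ n
  m≡1+n*o⇒[m∸1]/o≡n {n = n} {o} refl = m*n/n≡m n o

  Adjacent : ℕ → ℕ → ℕ → ℕ → Set
  Adjacent a₁ q₁ a₂ q₂ = a₂ * q₁ ≡ 1 + a₁ * q₂

  adjacent-mediant : ∀ a₁ q₁ a₂ q₂ → Adjacent a₁ q₁ a₂ q₂ → Adjacent a₁ q₁ (a₁ + a₂) (q₁ + q₂)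
  adjacent-mediant a₁ q₁ a₂ q₂ adj = begin
    (a₁ + a₂) * q₁           ≡⟨ *-distribʳ-+ q₁ a₁ a₂ ⟩
    a₁ * q₁ + a₂ * q₁        ≡⟨ cong (a₁ * q₁ +_) adj ⟩
    a₁ * q₁ + (1 + a₁ * q₂)  ≡⟨ solve (a₁ ∷ q₁ ∷ q₂ ∷ []) ⟩
    1 + a₁ * (q₁ + q₂)       ∎

  adjacent-reflect : ∀ a₁ q₁ a₂ q₂ → a₂ ≤ q₂ → Adjacent a₁ q₁ a₂ q₂ → Adjacent (q₂ ∸ a₂) q₂ (q₁ ∸ a₁) q₁
  adjacent-reflect a₁ q₁ a₂ q₂ a₂≤q₂ adj = begin
    (q₁ ∸ a₁) * q₂                 ≡⟨ *-distribʳ-∸ q₂ q₁ a₁ ⟩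
    q₁ * q₂ ∸ a₁ * q₂              ≡⟨ cong (suc (q₁ * q₂) ∸_) adj ⟨
    suc (q₁ * q₂) ∸ a₂ * q₁        ≡⟨ +-∸-assoc 1 a₂q₁≤q₁q₂ ⟩
    1 + (q₁ * q₂ ∸ a₂ * q₁)        ≡⟨ cong (λ t → 1 + (t ∸ a₂ * q₁)) (*-comm q₁ q₂) ⟩
    1 + (q₂ * q₁ ∸ a₂ * q₁)        ≡⟨ cong (1 +_) (*-distribʳ-∸ q₁ q₂ a₂) ⟨
    1 + (q₂ ∸ a₂) * q₁             ∎
    where
    a₂q₁≤q₁q₂ : a₂ * q₁ ≤ q₁ * q₂
    a₂q₁≤q₁q₂ = subst (a₂ * q₁ ≤_) (*-comm q₂ q₁) (*-monoˡ-≤ q₁ a₂≤q₂)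

open import Data.Integer using (ℤ; +_; _+_; _-_; _*_)
open import Data.Integer.Properties using (⊖-≥; m-n≡m⊖n; pos-*)
open import Data.Integer.Tactic.RingSolver using (solve-∀)

pos-∸ : ∀ {m n} → n ≤ m → + (m ∸ n) ≡ + m - + n
pos-∸ {m} {n} n≤m = sym (trans (m-n≡m⊖n m n) (⊖-≥ n≤m))

pos-m≡m%n+[m/n]*n : ∀ m n .{{_ : NonZero n}} → + m ≡ + (m % n) + + (m / n) * + n
pos-m≡m%n+[m/n]*n m n = trans (cong +_ (m≡m%n+[m/n]*n m n)) (cong (_+_ (+ (m % n))) (pos-* (m / n) n))

module FareyNeighbours
  {a₁ q₁ a₂ q₂ : ℕ} .{{_ : NonZero q₁}} .{{_ : NonZero q₂}}
  (0<a₁ : 0 < a₁) (a₁<q₁ : a₁ < q₁) (0<a₂ : 0 < a₂) (a₂<q₂ : a₂ < q₂)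
  (adj : Adjacent a₁ q₁ a₂ q₂)
  where

  private
    1<q₁ : 1 < q₁
    1<q₁ = ≤-<-trans 0<a₁ a₁<q₁

    1<q₂ : 1 < q₂
    1<q₂ = ≤-<-trans 0<a₂ a₂<q₂

    a₁q₂+1≡a₂q₁ : a₁ N.* q₂ N.+ 1 ≡ a₂ N.* q₁
    a₁q₂+1≡a₂q₁ = trans (+-comm (a₁ N.* q₂) 1) (sym adj)

  invmod-q₁-a₁ : invmod q₁ a₁ ≡ q₁ ∸ q₂ % q₁
  invmod-q₁-a₁ = n*m+1≡c*q⇒invmod≡q∸m%q a₂ 1<q₁ a₁q₂+1≡a₂q₁

  invmod-q₁-q₂ : invmod q₁ q₂ ≡ q₁ ∸ a₁
  invmod-q₁-q₂ = begin
    invmod q₁ q₂  ≡⟨ n*m+1≡c*q⇒invmod≡q∸m%q a₂ 1<q₁ q₂a₁+1≡a₂q₁ ⟩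
    q₁ ∸ a₁ % q₁  ≡⟨ cong (q₁ ∸_) (m<n⇒m%n≡m a₁<q₁) ⟩
    q₁ ∸ a₁       ∎
    where
    q₂a₁+1≡a₂q₁ : q₂ N.* a₁ N.+ 1 ≡ a₂ N.* q₁
    q₂a₁+1≡a₂q₁ = trans (cong (N._+ 1) (*-comm q₂ a₁)) a₁q₂+1≡a₂q₁

  invmod-q₂-q₁ : invmod q₂ q₁ ≡ a₂
  invmod-q₂-q₁ = trans (n*m≡1+c*q⇒invmod≡m%q a₁ 1<q₂ (trans (*-comm q₁ a₂) adj)) (m<n⇒m%n≡m a₂<q₂)

  invmod-q₂-a₂ : invmod q₂ a₂ ≡ q₁ % q₂
  invmod-q₂-a₂ = n*m≡1+c*q⇒invmod≡m%q a₁ 1<q₂ adj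

  invmod-mediant : invmod (q₁ N.+ q₂) (a₁ N.+ a₂) ≡ q₁
  invmod-mediant = trans (n*m≡1+c*q⇒invmod≡m%q a₁ 1<q₁+q₂ (adjacent-mediant a₁ q₁ a₂ q₂ adj))
                         (m<n⇒m%n≡m (m<m+n q₁ (<⇒≤ 1<q₂)))
    where
    1<q₁+q₂ : 1 < q₁ N.+ q₂
    1<q₁+q₂ = <-≤-trans 1<q₁ (m≤m+n q₁ q₂)

    instance
      q₁+q₂-nonZero : NonZero (q₁ N.+ q₂)
      q₁+q₂-nonZero = >-nonZero (<⇒≤ 1<q₁+q₂)

  [q₁*invmod-q₂-q₁∸1]/q₂≡a₁ : (q₁ N.* invmod q₂ q₁ ∸ 1) / q₂ ≡ a₁
  [q₁*invmod-q₂-q₁∸1]/q₂≡a₁ = m≡1+n*o⇒[m∸1]/o≡n (begin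
    q₁ N.* invmod q₂ q₁  ≡⟨ cong (q₁ N.*_) invmod-q₂-q₁ ⟩
    q₁ N.* a₂            ≡⟨ *-comm q₁ a₂ ⟩
    a₂ N.* q₁            ≡⟨ adj ⟩
    1 N.+ a₁ N.* q₂      ∎)

  [q₂*invmod-q₁-q₂∸1]/q₁≡q₂∸a₂ : (q₂ N.* invmod q₁ q₂ ∸ 1) / q₁ ≡ q₂ ∸ a₂
  [q₂*invmod-q₁-q₂∸1]/q₁≡q₂∸a₂ = m≡1+n*o⇒[m∸1]/o≡n (begin
    q₂ N.* invmod q₁ q₂       ≡⟨ cong (q₂ N.*_) invmod-q₁-q₂ ⟩
    q₂ N.* (q₁ ∸ a₁)          ≡⟨ *-comm q₂ (q₁ ∸ a₁) ⟩
    (q₁ ∸ a₁) N.* q₂          ≡⟨ adjacent-reflect a₁ q₁ a₂ q₂ (<⇒≤ a₂<q₂) adj ⟩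
    1 N.+ (q₂ ∸ a₂) N.* q₁    ∎)

  private
    +invmod-q₁-q₂ : + invmod q₁ q₂ ≡ + q₁ - + a₁
    +invmod-q₁-q₂ = trans (cong +_ invmod-q₁-q₂) (pos-∸ (<⇒≤ a₁<q₁))

    h-left≡ : + h a₁ q₁ ≡ + q₁ + + a₁ + (+ q₁ - + (q₂ % q₁))
    h-left≡ = cong (λ x → + q₁ + + a₁ + x) (trans (cong +_ invmod-q₁-a₁) (pos-∸ (m%n≤n q₂ q₁)))

    h-right≡ : + h a₂ q₂ ≡ + q₂ + + a₂ + + (q₁ % q₂)
    h-right≡ = cong (λ x → + q₂ + + a₂ + + x) invmod-q₂-a₂

    h-mediant≡ : + h (a₁ N.+ a₂) (q₁ N.+ q₂) ≡ + q₁ + + q₂ + (+ a₁ + + a₂) + + q₁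
    h-mediant≡ = cong (λ x → + q₁ + + q₂ + (+ a₁ + + a₂) + + x) invmod-mediant

  h-left-formula₁ : + h a₁ q₁ ≡ (+ 3 + + (q₂ / q₁)) * + q₁ - + q₂ - + invmod q₁ q₂
  h-left-formula₁ = begin
    + h a₁ q₁                                       ≡⟨ h-left≡ ⟩
    + q₁ + + a₁ + (+ q₁ - + r)                      ≡⟨ ring (+ q₁) (+ a₁) (+ r) (+ d) ⟩
    (+ 3 + + d) * + q₁ - (+ r + + d * + q₁) - (+ q₁ - + a₁)
      ≡⟨ cong₂ (λ x y → (+ 3 + + d) * + q₁ - x - y) (pos-m≡m%n+[m/n]*n q₂ q₁) +invmod-q₁-q₂ ⟨
    (+ 3 + + d) * + q₁ - + q₂ - + invmod q₁ q₂      ∎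
    where
    r d : ℕ
    r = q₂ % q₁
    d = q₂ / q₁
    ring : ∀ Q A R D → Q + A + (Q - R) ≡ (+ 3 + D) * Q - (R + D * Q) - (Q - A)
    ring = solve-∀

  h-left-formula₂ : + h a₁ q₁ ≡ (+ 2 + + (q₂ / q₁)) * + q₁ - + q₂ + + ((q₁ N.* invmod q₂ q₁ ∸ 1) / q₂)
  h-left-formula₂ = begin
    + h a₁ q₁                                       ≡⟨ h-left≡ ⟩
    + q₁ + + a₁ + (+ q₁ - + r)                      ≡⟨ ring (+ q₁) (+ a₁) (+ r) (+ d) ⟩
    (+ 2 + + d) * + q₁ - (+ r + + d * + q₁) + + a₁
      ≡⟨ cong₂ (λ x y → (+ 2 + + d) * + q₁ - x + + y)
               (pos-m≡m%n+[m/n]*n q₂ q₁) [q₁*invmod-q₂-q₁∸1]/q₂≡a₁ ⟨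
    (+ 2 + + d) * + q₁ - + q₂ + + ((q₁ N.* invmod q₂ q₁ ∸ 1) / q₂) ∎
    where
    r d : ℕ
    r = q₂ % q₁
    d = q₂ / q₁
    ring : ∀ Q A R D → Q + A + (Q - R) ≡ (+ 2 + D) * Q - (R + D * Q) + A
    ring = solve-∀

  h-right-formula₁ : + h a₂ q₂ ≡ (+ 1 - + (q₁ / q₂)) * + q₂ + + q₁ + + invmod q₂ q₁
  h-right-formula₁ = begin
    + h a₂ q₂                                       ≡⟨ h-right≡ ⟩
    + q₂ + + a₂ + + r                               ≡⟨ ring (+ q₂) (+ a₂) (+ r) (+ d) ⟩
    (+ 1 - + d) * + q₂ + (+ r + + d * + q₂) + + a₂
      ≡⟨ cong₂ (λ x y → (+ 1 - + d) * + q₂ + x + + y) (pos-m≡m%n+[m/n]*n q₁ q₂) invmod-q₂-q₁ ⟨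
    (+ 1 - + d) * + q₂ + + q₁ + + invmod q₂ q₁      ∎
    where
    r d : ℕ
    r = q₁ % q₂
    d = q₁ / q₂
    ring : ∀ Q A R D → Q + A + R ≡ (+ 1 - D) * Q + (R + D * Q) + A
    ring = solve-∀

  h-right-formula₂ : + h a₂ q₂ ≡ + q₁ + (+ 2 - + (q₁ / q₂)) * + q₂ - + ((q₂ N.* invmod q₁ q₂ ∸ 1) / q₁)
  h-right-formula₂ = begin
    + h a₂ q₂                                       ≡⟨ h-right≡ ⟩
    + q₂ + + a₂ + + r                               ≡⟨ ring (+ q₂) (+ a₂) (+ r) (+ d) ⟩
    (+ r + + d * + q₂) + (+ 2 - + d) * + q₂ - (+ q₂ - + a₂)
      ≡⟨ cong₂ (λ x y → x + (+ 2 - + d) * + q₂ - y) (pos-m≡m%n+[m/n]*n q₁ q₂) quotient≡ ⟨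
    + q₁ + (+ 2 - + d) * + q₂ - + ((q₂ N.* invmod q₁ q₂ ∸ 1) / q₁) ∎
    where
    r d : ℕ
    r = q₁ % q₂
    d = q₁ / q₂
    quotient≡ : + ((q₂ N.* invmod q₁ q₂ ∸ 1) / q₁) ≡ + q₂ - + a₂
    quotient≡ = trans (cong +_ [q₂*invmod-q₁-q₂∸1]/q₁≡q₂∸a₂) (pos-∸ (<⇒≤ a₂<q₂))
    ring : ∀ Q A R D → Q + A + R ≡ (R + D * Q) + (+ 2 - D) * Q - (Q - A)
    ring = solve-∀

  h-mediant-formula : + h (a₁ N.+ a₂) (q₁ N.+ q₂) ≡ + 3 * + q₁ + + q₂ + + invmod q₂ q₁ - + invmod q₁ q₂
  h-mediant-formula = begin
    + h (a₁ N.+ a₂) (q₁ N.+ q₂)                     ≡⟨ h-mediant≡ ⟩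
    + q₁ + + q₂ + (+ a₁ + + a₂) + + q₁              ≡⟨ ring (+ q₁) (+ q₂) (+ a₁) (+ a₂) ⟩
    + 3 * + q₁ + + q₂ + + a₂ - (+ q₁ - + a₁)
      ≡⟨ cong₂ (λ x y → + 3 * + q₁ + + q₂ + x - y) (cong +_ invmod-q₂-q₁) +invmod-q₁-q₂ ⟨
    + 3 * + q₁ + + q₂ + + invmod q₂ q₁ - + invmod q₁ q₂ ∎
    where
    ring : ∀ Q₁ Q₂ A₁ A₂ → Q₁ + Q₂ + (A₁ + A₂) + Q₁ ≡ + 3 * Q₁ + Q₂ + A₂ - (Q₁ - A₁)
    ring = solve-∀

lemma12 : (a₁ q₁ a₂ q₂ : ℕ) → .{{_ : NonZero q₁}} → .{{_ : NonZero q₂}} →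
    0 < a₁ → a₁ < q₁ → 0 < a₂ → a₂ < q₂ →
    a₂ N.* q₁ ≡ 1 N.+ a₁ N.* q₂ →
    ((+ h a₁ q₁ ≡ (+ 3 + + (q₂ / q₁)) * + q₁ - + q₂ - + invmod q₁ q₂)
      × (+ h a₁ q₁ ≡ (+ 2 + + (q₂ / q₁)) * + q₁ - + q₂ + + ((q₁ N.* invmod q₂ q₁ ∸ 1) / q₂)))
    × ((+ h a₂ q₂ ≡ (+ 1 - + (q₁ / q₂)) * + q₂ + + q₁ + + invmod q₂ q₁)
      × (+ h a₂ q₂ ≡ + q₁ + (+ 2 - + (q₁ / q₂)) * + q₂ - + ((q₂ N.* invmod q₁ q₂ ∸ 1) / q₁)))
    × (+ h (a₁ N.+ a₂) (q₁ N.+ q₂) ≡ + 3 * + q₁ + + q₂ + + invmod q₂ q₁ - + invmod q₁ q₂)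
lemma12 a₁ q₁ a₂ q₂ 0<a₁ a₁<q₁ 0<a₂ a₂<q₂ adj =
  (h-left-formula₁ , h-left-formula₂) , (h-right-formula₁ , h-right-formula₂) , h-mediant-formula
  where open FareyNeighbours 0<a₁ a₁<q₁ 0<a₂ a₂<q₂ adj
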